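{- Let $a,q$ be integers with $1\leq a<q$ and $\gcd(a,q)=1$. Then \[ S(a/q)-S(-q/a)=\sqrt{q/a}+E_{+}(a,q),\qquad S(-a/q)-S(q/a)=E_{ - }(a,q), \] where the error terms satisfy $|E_{\pm}(a,q)|\leq \tfrac32 k_{a/q}+3$, with $k_{a/q}$ the number of steps in the Euclidean division algorithm applied to $q/a$ (in particular $E_{\pm}(a,q)=O(\log(2+q))$).
   Context: For a rational number $x$, write $x=a/q$ in lowest terms with $a,q\in\mathbb{Z}$, $q>0$, $\gcd(a,q)=1$, and define \[ S(x)=S(a/q):=\#\{(m,n)\in\mathbb{Z}^2:\ m>0,\ n>0,\ mn<q,\ am\equiv n \pmod q\}. \] (This is a $1$-periodic function on $\mathbb{Q}$.) -}

module Defs where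

open import Data.Nat as ℕ using (ℕ; zero; suc; _%_)
open import Data.Nat.Divisibility using (_∣?_)
open import Data.Integer as ℤ using (ℤ; +_)
open import Data.Rational as ℚ using (ℚ; ↥_; ↧ₙ_; _≤_; 0ℚ)
open import Data.List using (List; length; filter; upTo; cartesianProduct)
open import Data.Product using (_×_; _,_)
open import Data.Sum using (_⊎_)
open import Relation.Nullary.Decidable using (_×-dec_)

-- Write x = a/q in lowest terms
-- (a = ↥ x, q = ↧ₙ x > 0; stdlib ℚ is always normalised), and count
-- pairs (m,n) with m > 0, n > 0, m n < q and a m ≡ n (mod q),
-- i.e. q ∣ (a m − n) in ℤ.  Such pairs automatically satisfy m, n < q,
-- so it suffices to search m, n ∈ {0, …, q−1}.
S : ℚ → ℕ
S x = length (filter P? (cartesianProduct (upTo q) (upTo q)))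
  where
  a : ℤ
  a = ↥ x
  q : ℕ
  q = ↧ₙ x
  P? : (mn : ℕ × ℕ) → _
  P? (m , n) =
    (1 ℕ.≤? m) ×-dec ((1 ℕ.≤? n) ×-dec ((suc (m ℕ.* n) ℕ.≤? q)
      ×-dec (q ∣? ℤ.∣ a ℤ.* (+ m) ℤ.- (+ n) ∣)))

-- Number of division steps of the Euclidean algorithm applied to x/y:
--   x = c₁ y + r₁, y = c₂ r₁ + r₂, …, stopping at the first zero remainder.
-- stepsAux fuel x y counts these steps; fuel (suc y) always suffices since
-- the second argument strictly decreases.
stepsAux : ℕ → ℕ → ℕ → ℕ
stepsAux zero    x y       = zero
stepsAux (suc f) x zero    = zero
stepsAux (suc f) x (suc y) = suc (stepsAux f (suc y) (x % suc y))

euclidSteps : (q a : ℕ) → ℕ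
euclidSteps q a = stepsAux (suc a) q a

-- |D − √x| ≤ B, for x ≥ 0, expressed without real numbers:
--   √x ≤ D + B   ⟺  0 ≤ D + B  and  x ≤ (D + B)²,
--   D − B ≤ √x   ⟺  D − B ≤ 0  or   (D − B)² ≤ x.
DistToSqrt≤ : (D x B : ℚ) → Set
DistToSqrt≤ D x B =
  (0ℚ ≤ D ℚ.+ B × x ≤ (D ℚ.+ B) ℚ.* (D ℚ.+ B))
  × (D ℚ.- B ≤ 0ℚ ⊎ (D ℚ.- B) ℚ.* (D ℚ.- B) ≤ x)

module Submission where

-- First (counting lemmas, pairs and triples) each pair counted by one of the four values of S is
-- encoded as a triple (m , n , l) with a m = q l + n (for S(a/q), S(−q/a)) or a m + n = q l (for
-- S(−a/q), S(q/a)); S( · /q) counts the triples with m n < q and S( · /a) those with l n < a.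
-- Comparing the two hyperbolic regions gives the exact identities S(a/q) + N⁺ = A + S(−q/a) and
-- S(−a/q) = S(q/a) + N⁻, where A = #{m ≥ 1 : a m² < q} ∈ [√(q/a) − 1, √(q/a)] and the defects N±
-- count triples in one region only.  A Euclidean step q = c a + r moves a defect triple (m , n , l)
-- to (l , n , m − c l), giving N⁺(a,q) ≤ N⁻(r,a) and N⁻(a,q) ≤ N⁺(r,a) + 3; induction along the
-- algorithm yields 2 N⁻ ≤ 3k + 1 and 2 N⁺ + 2 ≤ 3k.

open import Defs
open import Data.Nat as ℕ using (ℕ; _<_; _≤_)
open import Data.Nat.Properties using (≤-trans; <⇒≤)
open import Data.Nat.GCD using (gcd)
open import Data.Integer as ℤ using (ℤ; +_)
open import Data.Rational as ℚ using (ℚ; _/_)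
open import Data.Product using (_×_)
open import Relation.Binary.PropositionalEquality using (_≡_)

open import Data.Nat using (zero; suc; pred; _+_; _*_; _∸_; _%_; z≤n; s≤s; _≤?_; _<?_; _≟_; NonZero)
open import Data.Nat.Properties
open import Data.Nat.DivMod
  using (m≡m%n+[m/n]*n; [m+kn]%n≡m%n; m<n⇒m%n≡m; m%n<n; m*n/n≡m; m<n⇒m/n≡0; m<n*o⇒m/o<n; m*[n/m]≡n;
         m≥n⇒m/n>0; +-distrib-/-∣ˡ)
open import Data.Nat.Divisibility using (_∣_; divides; _∣?_; ∣⇒≤)
open import Data.Nat.GCD using (gcd-comm)
open import Data.Nat.Induction using (<-rec)
import Data.Nat.Tactic.RingSolver as ℕ-Solver
open import Data.Integer using (_⊖_)
import Data.Integer.Properties as ℤP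
import Data.Integer.Tactic.RingSolver as ℤ-Solver
open import Data.Rational using (fromℚᵘ)
import Data.Rational.Properties as ℚP
open import Data.Rational.Unnormalised as ℚᵘ using (ℚᵘ; mkℚᵘ)
import Data.Rational.Unnormalised.Properties as ℚᵘP
open import Data.List using (List; []; _∷_; _++_; length; filter; upTo; cartesianProduct)
open import Data.List.Properties using (filter-accept; filter-all; filter-none; length-upTo)
open import Data.List.Membership.Propositional using (_∈_)
open import Data.List.Membership.Propositional.Properties
  using (∈-∃++; ∈-upTo⁺; ∈-upTo⁻; ∈-cartesianProduct⁺; ∈-cartesianProduct⁻)
open import Data.List.Relation.Unary.Any using (here; there)
open import Data.List.Relation.Unary.All as All using (All)
open import Data.List.Relation.Unary.AllPairs using (_∷_)
open import Data.List.Relation.Unary.Unique.Propositional using (Unique)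
open import Data.List.Relation.Unary.Unique.Propositional.Properties using (applyUpTo⁺₁; cartesianProduct⁺)
open import Data.Product using (_,_; proj₁; proj₂)
open import Data.Sum using (_⊎_; inj₁; inj₂)
open import Data.Unit using (⊤; tt)
open import Data.Empty using (⊥; ⊥-elim)
open import Function using (id)
open import Relation.Nullary using (¬_; Dec; yes; no; contradiction)
open import Relation.Nullary.Decidable using (_×-dec_)
open import Relation.Unary using (Decidable; _∩_; ∁)
open import Relation.Unary.Properties using (_∩?_; ∁?)
open import Relation.Binary using (tri<; tri≈; tri>)
open import Relation.Binary.PropositionalEquality using (refl; sym; trans; cong; cong₂; subst; subst₂; _≢_; ≢-sym; module ≡-Reasoning)

count : {A : Set} {P : A → Set} → Decidable P → List A → ℕ
count P? xs = length (filter P? xs)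

always : {A : Set} → Decidable {A = A} (λ _ → ⊤)
always _ = yes tt

count-always : {A : Set} (xs : List A) → count always xs ≡ length xs
count-always xs = cong length (filter-all always {xs} (All.tabulate (λ _ → tt)))

module _ {A : Set} {P : A → Set} (P? : Decidable P) where

  count-middle : ∀ (us vs : List A) {y} → P y →
    count P? (us ++ y ∷ vs) ≡ suc (count P? (us ++ vs))
  count-middle []       vs py = cong length (filter-accept P? py)
  count-middle (u ∷ us) vs py with P? u
  ... | yes _ = cong suc (count-middle us vs py)
  ... | no  _ = count-middle us vs py

  count-none : ∀ (xs : List A) → (∀ {x} → x ∈ xs → ¬ P x) → count P? xs ≡ 0
  count-none xs h = cong length (filter-none P? (All.tabulate h))

∈-remove : ∀ {A : Set} {x y : A} (us vs : List A) → y ∈ us ++ x ∷ vs → y ≢ x → y ∈ us ++ vs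
∈-remove []       vs (here refl) y≢x = ⊥-elim (y≢x refl)
∈-remove []       vs (there y∈)  y≢x = y∈
∈-remove (u ∷ us) vs (here refl) y≢x = here refl
∈-remove (u ∷ us) vs (there y∈)  y≢x = there (∈-remove us vs y∈ y≢x)

module _ {A B : Set} {P : A → Set} {Q : B → Set} (P? : Decidable P) (Q? : Decidable Q) where

  count-injection : ∀ (f : A → B) (xs : List A) (ys : List B) → Unique xs →
    (∀ {x} → x ∈ xs → P x → f x ∈ ys × Q (f x)) →
    (∀ {x y} → x ∈ xs → y ∈ xs → P x → P y → f x ≡ f y → x ≡ y) →
    count P? xs ≤ count Q? ys
  count-injection f []       ys _            _    _   = z≤n
  count-injection f (x ∷ xs) ys (x∉xs ∷ uxs) maps inj with P? x
  ... | no _ = count-injection f xs ys uxs (λ z∈ → maps (there z∈)) (λ z∈ w∈ → inj (there z∈) (there w∈))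
  ... | yes px with ∈-∃++ (proj₁ (maps (here refl) px))
  ... | us , vs , refl rewrite count-middle Q? us vs (proj₂ (maps (here refl) px)) =
    s≤s (count-injection f xs (us ++ vs) uxs maps′ (λ z∈ w∈ → inj (there z∈) (there w∈)))
    where
    maps′ : ∀ {z} → z ∈ xs → P z → f z ∈ us ++ vs × Q (f z)
    maps′ z∈ pz = ∈-remove us vs (proj₁ (maps (there z∈) pz))
                    (λ fz≡fx → All.lookup x∉xs z∈ (sym (inj (there z∈) (here refl) pz px fz≡fx)))
                , proj₂ (maps (there z∈) pz)

  count-retraction : ∀ (f : A → B) (g : B → A) (xs : List A) (ys : List B) → Unique xs →
    (∀ {x} → x ∈ xs → P x → f x ∈ ys × Q (f x)) →
    (∀ {x} → x ∈ xs → P x → g (f x) ≡ x) →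
    count P? xs ≤ count Q? ys
  count-retraction f g xs ys uxs maps gf = count-injection f xs ys uxs maps inj
    where
    inj : ∀ {x y} → x ∈ xs → y ∈ xs → P x → P y → f x ≡ f y → x ≡ y
    inj x∈ y∈ px py fx≡fy = trans (sym (gf x∈ px)) (trans (cong g fx≡fy) (gf y∈ py))

count-bijection : ∀ {A B : Set} {P : A → Set} {Q : B → Set} (P? : Decidable P) (Q? : Decidable Q)
  (f : A → B) (g : B → A) (xs : List A) (ys : List B) → Unique xs → Unique ys →
  (∀ {x} → x ∈ xs → P x → f x ∈ ys × Q (f x)) →
  (∀ {y} → y ∈ ys → Q y → g y ∈ xs × P (g y)) →
  (∀ {x} → x ∈ xs → P x → g (f x) ≡ x) →
  (∀ {y} → y ∈ ys → Q y → f (g y) ≡ y) →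
  count P? xs ≡ count Q? ys
count-bijection P? Q? f g xs ys uxs uys f-maps g-maps gf fg =
  ≤-antisym (count-retraction P? Q? f g xs ys uxs f-maps gf)
            (count-retraction Q? P? g f ys xs uys g-maps fg)

count-≤-length : ∀ {A B : Set} {P : A → Set} (P? : Decidable P)
  (f : A → B) (xs : List A) (ys : List B) → Unique xs →
  (∀ {x} → x ∈ xs → P x → f x ∈ ys) →
  (∀ {x y} → x ∈ xs → y ∈ xs → P x → P y → f x ≡ f y → x ≡ y) →
  count P? xs ≤ length ys
count-≤-length P? f xs ys uxs maps inj =
  subst (count P? xs ≤_) (count-always ys)
        (count-injection P? always f xs ys uxs (λ x∈ px → maps x∈ px , tt) inj)

module _ {A : Set} {P Q : A → Set} (P? : Decidable P) (Q? : Decidable Q) where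

  count-mono : ∀ (xs : List A) → (∀ {x} → x ∈ xs → P x → Q x) → count P? xs ≤ count Q? xs
  count-mono []       _      = z≤n
  count-mono (x ∷ xs) P⇒Q with ih ← count-mono xs (λ x∈ → P⇒Q (there x∈)) | P? x | Q? x
  ... | yes _  | yes _  = s≤s ih
  ... | yes px | no ¬qx = ⊥-elim (¬qx (P⇒Q (here refl) px))
  ... | no _   | yes _  = m≤n⇒m≤1+n ih
  ... | no _   | no _   = ih

count-cong : ∀ {A : Set} {P Q : A → Set} (P? : Decidable P) (Q? : Decidable Q) (xs : List A) →
  (∀ {x} → x ∈ xs → P x → Q x) → (∀ {x} → x ∈ xs → Q x → P x) → count P? xs ≡ count Q? xs
count-cong P? Q? xs P⇒Q Q⇒P = ≤-antisym (count-mono P? Q? xs P⇒Q) (count-mono Q? P? xs Q⇒P)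

count-split : ∀ {A : Set} {P R : A → Set} (P? : Decidable P) (R? : Decidable R) (xs : List A) →
  count P? xs ≡ count (P? ∩? R?) xs + count (P? ∩? ∁? R?) xs
count-split P? R? []       = refl
count-split P? R? (x ∷ xs) with ih ← count-split P? R? xs | P? x | R? x
... | yes _ | yes _ = cong suc ih
... | yes _ | no  _ = trans (cong suc ih) (sym (+-suc _ _))
... | no  _ | yes _ = ih
... | no  _ | no  _ = ih

pairs : ℕ → List (ℕ × ℕ)
pairs n = cartesianProduct (upTo n) (upTo n)

Triple : Set
Triple = ℕ × ℕ × ℕ

triples : ℕ → List Triple
triples n = cartesianProduct (upTo n) (pairs n)

upTo-unique : ∀ n → Unique (upTo n)
upTo-unique n = applyUpTo⁺₁ id n (λ i<j _ → <⇒≢ i<j)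

pairs-unique : ∀ n → Unique (pairs n)
pairs-unique n = cartesianProduct⁺ (upTo-unique n) (upTo-unique n)

triples-unique : ∀ n → Unique (triples n)
triples-unique n = cartesianProduct⁺ (upTo-unique n) (pairs-unique n)

∈-pairs⁺ : ∀ {n x y} → x < n → y < n → (x , y) ∈ pairs n
∈-pairs⁺ x<n y<n = ∈-cartesianProduct⁺ (∈-upTo⁺ x<n) (∈-upTo⁺ y<n)

∈-pairs⁻ : ∀ n {x y} → (x , y) ∈ pairs n → x < n × y < n
∈-pairs⁻ n xy∈ with x∈ , y∈ ← ∈-cartesianProduct⁻ (upTo n) (upTo n) xy∈ = ∈-upTo⁻ x∈ , ∈-upTo⁻ y∈

∈-triples⁺ : ∀ {n x y z} → x < n → y < n → z < n → (x , y , z) ∈ triples n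
∈-triples⁺ x<n y<n z<n = ∈-cartesianProduct⁺ (∈-upTo⁺ x<n) (∈-pairs⁺ y<n z<n)

∈-triples⁻ : ∀ n {x y z} → (x , y , z) ∈ triples n → x < n × y < n × z < n
∈-triples⁻ n xyz∈ with x∈ , yz∈ ← ∈-cartesianProduct⁻ (upTo n) (pairs n) xyz∈ = ∈-upTo⁻ x∈ , ∈-pairs⁻ n yz∈

Counted : ℤ → ℕ → ℕ × ℕ → Set
Counted z q (m , n) = 1 ≤ m × 1 ≤ n × m * n < q × q ∣ ℤ.∣ z ℤ.* + m ℤ.- + n ∣

Counted? : (z : ℤ) (q : ℕ) (mn : ℕ × ℕ) → Dec (Counted z q mn)
Counted? z q (m , n) = (1 ≤? m) ×-dec (1 ≤? n) ×-dec (m * n <? q) ×-dec (q ∣? ℤ.∣ z ℤ.* + m ℤ.- + n ∣)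

-- S(z/q) computed from an unreduced numerator and denominator.
Sᶻ : ℤ → ℕ → ℕ
Sᶻ z q = count (Counted? z q) (pairs q)

S-reduced : ∀ i n .{{_ : NonZero n}} → gcd ℤ.∣ i ∣ n ≡ 1 → S (i / n) ≡ Sᶻ i n
S-reduced i n coprime = cong₂ Sᶻ numerator denominator
  where
  numerator : ℚ.↥ (i / n) ≡ i
  numerator = trans (sym (ℤP.*-identityʳ _))
                (trans (cong (λ g → ℚ.↥ (i / n) ℤ.* + g) (sym coprime)) (ℚP.↥-/ i n))
  denominator : ℚ.↧ₙ (i / n) ≡ n
  denominator = ℤP.+-injective (trans (sym (ℤP.*-identityʳ _))
                  (trans (cong (λ g → ℚ.↧ (i / n) ℤ.* + g) (sym coprime)) (ℚP.↧-/ i n)))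

S-reduced⁺ : ∀ m n .{{_ : NonZero n}} → gcd m n ≡ 1 → S ((+ m) / n) ≡ Sᶻ (+ m) n
S-reduced⁺ m n = S-reduced (+ m) n

S-reduced⁻ : ∀ m n .{{_ : NonZero n}} → gcd m n ≡ 1 → S ((ℤ.- + m) / n) ≡ Sᶻ (ℤ.- + m) n
S-reduced⁻ m n m⊥n = S-reduced (ℤ.- + m) n (trans (cong (λ i → gcd i n) (ℤP.∣-i∣≡∣i∣ (+ m))) m⊥n)

residue-pos : ∀ c m n → ℤ.∣ + c ℤ.* + m ℤ.- + n ∣ ≡ ℤ.∣ c * m ⊖ n ∣
residue-pos c m n rewrite sym (ℤP.pos-* c m) = cong ℤ.∣_∣ (ℤP.[+m]-[+n]≡m⊖n (c * m) n)

residue-neg : ∀ c m n → ℤ.∣ ℤ.- (+ c) ℤ.* + m ℤ.- + n ∣ ≡ c * m + n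
residue-neg c m n = begin
  ℤ.∣ ℤ.- (+ c) ℤ.* + m ℤ.- + n ∣    ≡⟨ cong (λ t → ℤ.∣ t ℤ.- + n ∣) (sym (ℤP.neg-distribˡ-* (+ c) (+ m))) ⟩
  ℤ.∣ ℤ.- (+ c ℤ.* + m) ℤ.- + n ∣    ≡⟨ cong ℤ.∣_∣ (sym (ℤP.neg-distrib-+ (+ c ℤ.* + m) (+ n))) ⟩
  ℤ.∣ ℤ.- (+ c ℤ.* + m ℤ.+ + n) ∣    ≡⟨ ℤP.∣-i∣≡∣i∣ (+ c ℤ.* + m ℤ.+ + n) ⟩
  ℤ.∣ + c ℤ.* + m ℤ.+ + n ∣          ≡⟨ cong (λ t → ℤ.∣ t ℤ.+ + n ∣) (sym (ℤP.pos-* c m)) ⟩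
  c * m + n                          ∎
  where open ≡-Reasoning

congruence⇒division : ∀ {q x n} .{{_ : NonZero q}} → n < q → q ∣ ℤ.∣ x ⊖ n ∣ → x ≡ q * (x ℕ./ q) + n
congruence⇒division {q} {x} {n} n<q q∣x⊖n with n ≤? x
... | yes n≤x rewrite ℤP.⊖-≥ n≤x with divides t x∸n≡tq ← q∣x⊖n = begin
  x                          ≡⟨ m≡m%n+[m/n]*n x q ⟩
  x % q + x ℕ./ q * q        ≡⟨ cong (λ u → u % q + x ℕ./ q * q) x≡n+tq ⟩
  (n + t * q) % q + x ℕ./ q * q ≡⟨ cong (_+ x ℕ./ q * q) (trans ([m+kn]%n≡m%n n t q) (m<n⇒m%n≡m n<q)) ⟩
  n + x ℕ./ q * q            ≡⟨ trans (+-comm n _) (cong (_+ n) (*-comm (x ℕ./ q) q)) ⟩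
  q * (x ℕ./ q) + n          ∎
  where
  open ≡-Reasoning
  x≡n+tq : x ≡ n + t * q
  x≡n+tq = trans (sym (m∸n+n≡m n≤x)) (trans (cong (_+ n) x∸n≡tq) (+-comm (t * q) n))
... | no n≰x = contradiction (≤-trans q≤n∸x (m∸n≤m n x)) (<⇒≱ n<q)
  where
  x<n : x < n
  x<n = ≰⇒> n≰x
  instance
    _ : NonZero (n ∸ x)
    _ = ℕ.>-nonZero (m<n⇒0<n∸m x<n)
  q≤n∸x : q ≤ n ∸ x
  q≤n∸x = ∣⇒≤ (subst (q ∣_) (trans (cong ℤ.∣_∣ (ℤP.⊖-< x<n)) (ℤP.∣-i∣≡∣i∣ (+ (n ∸ x)))) q∣x⊖n)

division⇒congruence : ∀ {q x n l} → x ≡ q * l + n → q ∣ ℤ.∣ x ⊖ n ∣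
division⇒congruence {q} {x} {n} {l} refl
  rewrite ℤP.⊖-≥ (m≤n+m n (q * l)) | m+n∸n≡m (q * l) n = divides l (*-comm q l)

quotient-exact : ∀ d k .{{_ : NonZero d}} → (d * k) ℕ./ d ≡ k
quotient-exact d k = trans (cong (ℕ._/ d) (*-comm d k)) (m*n/n≡m k d)

quotient-with-remainder : ∀ {d} k {n} .{{_ : NonZero d}} → n < d → (d * k + n) ℕ./ d ≡ k
quotient-with-remainder {d} k {n} n<d = begin
  (d * k + n) ℕ./ d              ≡⟨ +-distrib-/-∣ˡ n (divides k (*-comm d k)) ⟩
  (d * k) ℕ./ d + n ℕ./ d        ≡⟨ cong₂ _+_ (quotient-exact d k) (m<n⇒m/n≡0 n<d) ⟩
  k + 0                          ≡⟨ +-identityʳ k ⟩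
  k                              ∎
  where open ≡-Reasoning

digits-bound : ∀ {B x y z} → x < B → y < B → z < B → x * y + z < B * B
digits-bound {B} {x} {y} {z} x<B y<B z<B = begin-strict
  x * y + z  <⟨ +-monoʳ-< (x * y) z<B ⟩
  x * y + B  ≤⟨ +-monoˡ-≤ B (*-monoʳ-≤ x (<⇒≤ y<B)) ⟩
  x * B + B  ≡⟨ +-comm (x * B) B ⟩
  suc x * B  ≤⟨ *-monoˡ-≤ B x<B ⟩
  B * B      ∎
  where open ≤-Reasoning

factor-left : ∀ {x y b} → 1 ≤ y → x * y < b → x < b
factor-left {x} {suc y} _ xy<b = ≤-<-trans (m≤m*n x (suc y)) xy<b

factor-right : ∀ {x y b} → 1 ≤ x → x * y < b → y < b
factor-right {suc x} {y} _ xy<b = ≤-<-trans (m≤n*m y (suc x)) xy<b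

-- A triple (m , n , l) records a solution of a congruence together with its quotient l:
--   Plus a q :  a m = q l + n,  i.e.  a m ≡ n (mod q);
--   Minus a q : a m + n = q l,  i.e. −a m ≡ n (mod q).
Plus Minus : ℕ → ℕ → Triple → Set
Plus  a q (m , n , l) = a * m ≡ q * l + n
Minus a q (m , n , l) = a * m + n ≡ q * l

Plus? : ∀ a q → Decidable (Plus a q)
Minus? : ∀ a q → Decidable (Minus a q)
Plus?  a q (m , n , l) = a * m ≟ q * l + n
Minus? a q (m , n , l) = a * m + n ≟ q * l

-- The two hyperbolic regions: m n < q (as in S( · /q)) and l n < a (as in S( · /a)).
UnderMN UnderLN : ℕ → Triple → Set
UnderMN q (m , n , l) = 1 ≤ m × 1 ≤ n × m * n < q
UnderLN a (m , n , l) = 1 ≤ l × 1 ≤ n × l * n < a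

UnderMN? : ∀ q → Decidable (UnderMN q)
UnderLN? : ∀ a → Decidable (UnderLN a)
UnderMN? q (m , n , l) = (1 ≤? m) ×-dec (1 ≤? n) ×-dec (m * n <? q)
UnderLN? a (m , n , l) = (1 ≤? l) ×-dec (1 ≤? n) ×-dec (l * n <? a)

drop-quotient drop-multiplier : Triple → ℕ × ℕ
drop-quotient   (m , n , l) = m , n
drop-multiplier (m , n , l) = l , n

#T : {P : Triple → Set} → Decidable P → ℕ → ℕ
#T P? B = count P? (triples B)

-- Each of the four values of S in the theorem counts one family of triples:
-- the quotient l (resp. the multiplier m) is determined by the other two entries.
module TripleCounts (a q : ℕ) .{{_ : NonZero a}} .{{_ : NonZero q}} (a<q : a < q) where

  S⁺-as-triples : Sᶻ (+ a) q ≡ #T (Plus? a q ∩? UnderMN? q) q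
  S⁺-as-triples = count-bijection (Counted? (+ a) q) (Plus? a q ∩? UnderMN? q)
    f drop-quotient (pairs q) (triples q) (pairs-unique q) (triples-unique q) f-maps g-maps (λ _ _ → refl) fg
    where
    f : ℕ × ℕ → Triple
    f (m , n) = m , n , (a * m) ℕ./ q
    f-maps : ∀ {x} → x ∈ pairs q → Counted (+ a) q x → f x ∈ triples q × (Plus a q ∩ UnderMN q) (f x)
    f-maps {m , n} mn∈ (1≤m , 1≤n , mn<q , q∣) = ∈-triples⁺ m<q n<q l<q , am≡ , 1≤m , 1≤n , mn<q
      where
      m<q : m < q
      m<q = proj₁ (∈-pairs⁻ q mn∈)
      n<q : n < q
      n<q = proj₂ (∈-pairs⁻ q mn∈)
      am≡ : a * m ≡ q * (a * m ℕ./ q) + n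
      am≡ = congruence⇒division n<q (subst (q ∣_) (residue-pos a m n) q∣)
      l<q : a * m ℕ./ q < q
      l<q = m<n*o⇒m/o<n (*-mono-< a<q m<q)
    g-maps : ∀ {t} → t ∈ triples q → (Plus a q ∩ UnderMN q) t → drop-quotient t ∈ pairs q × Counted (+ a) q (drop-quotient t)
    g-maps {m , n , l} t∈ (am≡ , 1≤m , 1≤n , mn<q) =
      ∈-pairs⁺ (proj₁ (∈-triples⁻ q t∈)) (proj₁ (proj₂ (∈-triples⁻ q t∈))) , 1≤m , 1≤n , mn<q ,
      subst (q ∣_) (sym (residue-pos a m n)) (division⇒congruence am≡)
    fg : ∀ {t} → t ∈ triples q → (Plus a q ∩ UnderMN q) t → f (drop-quotient t) ≡ t
    fg {m , n , l} t∈ (am≡ , _) =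
      cong (λ u → m , n , u) (trans (cong (ℕ._/ q) am≡) (quotient-with-remainder l (proj₁ (proj₂ (∈-triples⁻ q t∈)))))

  S⁻-recip-as-triples : Sᶻ (ℤ.- + q) a ≡ #T (Plus? a q ∩? UnderLN? a) q
  S⁻-recip-as-triples = count-bijection (Counted? (ℤ.- + q) a) (Plus? a q ∩? UnderLN? a)
    f drop-multiplier (pairs a) (triples q) (pairs-unique a) (triples-unique q) f-maps g-maps (λ _ _ → refl) fg
    where
    f : ℕ × ℕ → Triple
    f (l , n) = (q * l + n) ℕ./ a , n , l
    f-maps : ∀ {x} → x ∈ pairs a → Counted (ℤ.- + q) a x → f x ∈ triples q × (Plus a q ∩ UnderLN a) (f x)
    f-maps {l , n} ln∈ (1≤l , 1≤n , ln<a , a∣) =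
      ∈-triples⁺ m<q (<-trans n<a a<q) (<-trans l<a a<q) , am≡ , 1≤l , 1≤n , ln<a
      where
      l<a : l < a
      l<a = proj₁ (∈-pairs⁻ a ln∈)
      n<a : n < a
      n<a = proj₂ (∈-pairs⁻ a ln∈)
      am≡ : a * ((q * l + n) ℕ./ a) ≡ q * l + n
      am≡ = m*[n/m]≡n (subst (a ∣_) (residue-neg q l n) a∣)
      m<q : (q * l + n) ℕ./ a < q
      m<q = m<n*o⇒m/o<n (begin-strict
        q * l + n  <⟨ +-monoʳ-< (q * l) (<-trans n<a a<q) ⟩
        q * l + q  ≡⟨ trans (+-comm (q * l) q) (sym (*-suc q l)) ⟩
        q * suc l  ≤⟨ *-monoʳ-≤ q l<a ⟩
        q * a      ∎)
        where open ≤-Reasoning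
    g-maps : ∀ {t} → t ∈ triples q → (Plus a q ∩ UnderLN a) t →
             drop-multiplier t ∈ pairs a × Counted (ℤ.- + q) a (drop-multiplier t)
    g-maps {m , n , l} _ (am≡ , 1≤l , 1≤n , ln<a) =
      ∈-pairs⁺ (factor-left 1≤n ln<a) (factor-right 1≤l ln<a) , 1≤l , 1≤n , ln<a ,
      subst (a ∣_) (sym (residue-neg q l n)) (divides m (trans (sym am≡) (*-comm a m)))
    fg : ∀ {t} → t ∈ triples q → (Plus a q ∩ UnderLN a) t → f (drop-multiplier t) ≡ t
    fg {m , n , l} _ (am≡ , _) = cong (λ u → u , n , l) (trans (cong (ℕ._/ a) (sym am≡)) (quotient-exact a m))

  S⁻-as-triples : Sᶻ (ℤ.- + a) q ≡ #T (Minus? a q ∩? UnderMN? q) q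
  S⁻-as-triples = count-bijection (Counted? (ℤ.- + a) q) (Minus? a q ∩? UnderMN? q)
    f drop-quotient (pairs q) (triples q) (pairs-unique q) (triples-unique q) f-maps g-maps (λ _ _ → refl) fg
    where
    f : ℕ × ℕ → Triple
    f (m , n) = m , n , (a * m + n) ℕ./ q
    f-maps : ∀ {x} → x ∈ pairs q → Counted (ℤ.- + a) q x → f x ∈ triples q × (Minus a q ∩ UnderMN q) (f x)
    f-maps {m , n} mn∈ (1≤m , 1≤n , mn<q , q∣) =
      ∈-triples⁺ m<q n<q (m<n*o⇒m/o<n (digits-bound a<q m<q n<q)) , sym ql≡ , 1≤m , 1≤n , mn<q
      where
      m<q : m < q
      m<q = proj₁ (∈-pairs⁻ q mn∈)
      n<q : n < q
      n<q = proj₂ (∈-pairs⁻ q mn∈)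
      ql≡ : q * ((a * m + n) ℕ./ q) ≡ a * m + n
      ql≡ = m*[n/m]≡n (subst (q ∣_) (residue-neg a m n) q∣)
    g-maps : ∀ {t} → t ∈ triples q → (Minus a q ∩ UnderMN q) t →
             drop-quotient t ∈ pairs q × Counted (ℤ.- + a) q (drop-quotient t)
    g-maps {m , n , l} t∈ (am+n≡ , 1≤m , 1≤n , mn<q) =
      ∈-pairs⁺ (proj₁ (∈-triples⁻ q t∈)) (proj₁ (proj₂ (∈-triples⁻ q t∈))) , 1≤m , 1≤n , mn<q ,
      subst (q ∣_) (sym (residue-neg a m n)) (divides l (trans am+n≡ (*-comm q l)))
    fg : ∀ {t} → t ∈ triples q → (Minus a q ∩ UnderMN q) t → f (drop-quotient t) ≡ t
    fg {m , n , l} _ (am+n≡ , _) = cong (λ u → m , n , u) (trans (cong (ℕ._/ q) am+n≡) (quotient-exact q l))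

  S⁺-recip-as-triples : Sᶻ (+ q) a ≡ #T (Minus? a q ∩? UnderLN? a) q
  S⁺-recip-as-triples = count-bijection (Counted? (+ q) a) (Minus? a q ∩? UnderLN? a)
    f drop-multiplier (pairs a) (triples q) (pairs-unique a) (triples-unique q) f-maps g-maps (λ _ _ → refl) fg
    where
    f : ℕ × ℕ → Triple
    f (l , n) = (q * l) ℕ./ a , n , l
    f-maps : ∀ {x} → x ∈ pairs a → Counted (+ q) a x → f x ∈ triples q × (Minus a q ∩ UnderLN a) (f x)
    f-maps {l , n} ln∈ (1≤l , 1≤n , ln<a , a∣) =
      ∈-triples⁺ m<q (<-trans n<a a<q) (<-trans l<a a<q) , sym ql≡ , 1≤l , 1≤n , ln<a
      where
      l<a : l < a
      l<a = proj₁ (∈-pairs⁻ a ln∈)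
      n<a : n < a
      n<a = proj₂ (∈-pairs⁻ a ln∈)
      ql≡ : q * l ≡ a * (q * l ℕ./ a) + n
      ql≡ = congruence⇒division n<a (subst (a ∣_) (residue-pos q l n) a∣)
      m<q : q * l ℕ./ a < q
      m<q = m<n*o⇒m/o<n (*-monoʳ-< q l<a)
    g-maps : ∀ {t} → t ∈ triples q → (Minus a q ∩ UnderLN a) t →
             drop-multiplier t ∈ pairs a × Counted (+ q) a (drop-multiplier t)
    g-maps {m , n , l} _ (am+n≡ , 1≤l , 1≤n , ln<a) =
      ∈-pairs⁺ (factor-left 1≤n ln<a) (factor-right 1≤l ln<a) , 1≤l , 1≤n , ln<a ,
      subst (a ∣_) (sym (residue-pos q l n)) (division⇒congruence (sym am+n≡))
    fg : ∀ {t} → t ∈ triples q → (Minus a q ∩ UnderLN a) t → f (drop-multiplier t) ≡ t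
    fg {m , n , l} _ (am+n≡ , 1≤l , _ , ln<a) =
      cong (λ u → u , n , l) (trans (cong (ℕ._/ a) (sym am+n≡)) (quotient-with-remainder m (factor-right 1≤l ln<a)))

QuotientZero MNBelow LNBelow : ℕ → Triple → Set
QuotientZero _ (m , n , l) = l ≡ 0
MNBelow q (m , n , l) = m * n < q
LNBelow a (m , n , l) = l * n < a

QuotientZero? : ∀ b → Decidable (QuotientZero b)
QuotientZero? _ (m , n , l) = l ≟ 0
MNBelow? : ∀ q → Decidable (MNBelow q)
MNBelow? q (m , n , l) = m * n <? q
LNBelow? : ∀ a → Decidable (LNBelow a)
LNBelow? a (m , n , l) = l * n <? a

N⁺ N⁻ : ℕ → ℕ → Triple → Set
N⁺ a q = (Plus a q ∩ UnderLN a) ∩ ∁ (MNBelow q)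
N⁻ a q = (Minus a q ∩ UnderMN q) ∩ ∁ (LNBelow a)

N⁺? : ∀ a q → Decidable (N⁺ a q)
N⁺? a q = (Plus? a q ∩? UnderLN? a) ∩? ∁? (MNBelow? q)

N⁻? : ∀ a q → Decidable (N⁻ a q)
N⁻? a q = (Minus? a q ∩? UnderMN? q) ∩? ∁? (LNBelow? a)

-- Number of m ≥ 1 with a m² < q: the lattice-point count approximating √(q/a).
Square : ℕ → ℕ → ℕ → Set
Square a q m = 1 ≤ m × a * (m * m) < q

Square? : ∀ a q → Decidable (Square a q)
Square? a q m = (1 ≤? m) ×-dec (a * (m * m) <? q)

√-count : ℕ → ℕ → ℕ
√-count a q = count (Square? a q) (upTo q)

product-expand : ∀ q l n → (q * l + n) * n ≡ q * (l * n) + n * n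
product-expand q l n = trans (*-distribʳ-+ n (q * l) n) (cong (_+ n * n) (*-assoc q l n))

module Transfer (a q : ℕ) .{{_ : NonZero a}} .{{_ : NonZero q}} where

  plus-LNBelow : ∀ {m n l} → a * m ≡ q * l + n → m * n < q → l * n < a
  plus-LNBelow {m} {n} {l} am≡ mn<q = *-cancelˡ-< q _ _ (begin-strict
    q * (l * n)          ≤⟨ m≤m+n _ (n * n) ⟩
    q * (l * n) + n * n  ≡⟨ sym (product-expand q l n) ⟩
    (q * l + n) * n      ≡⟨ cong (_* n) (sym am≡) ⟩
    a * m * n            ≡⟨ *-assoc a m n ⟩
    a * (m * n)          <⟨ *-monoʳ-< a mn<q ⟩
    a * q                ≡⟨ *-comm a q ⟩
    q * a                ∎)
    where open ≤-Reasoning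

  minus-MNBelow : ∀ {m n l} → a * m + n ≡ q * l → l * n < a → m * n < q
  minus-MNBelow {m} {n} {l} am+n≡ ln<a = *-cancelˡ-< a _ _ (begin-strict
    a * (m * n)          ≤⟨ m≤m+n _ (n * n) ⟩
    a * (m * n) + n * n  ≡⟨ sym (product-expand a m n) ⟩
    (a * m + n) * n      ≡⟨ cong (_* n) am+n≡ ⟩
    q * l * n            ≡⟨ *-assoc q l n ⟩
    q * (l * n)          <⟨ *-monoʳ-< q ln<a ⟩
    q * a                ≡⟨ *-comm q a ⟩
    a * q                ∎)
    where open ≤-Reasoning

plus-m-positive : ∀ {a q m n l} → a * m ≡ q * l + n → 1 ≤ n → 1 ≤ m
plus-m-positive {a} {q} {zero} {n} {l} am≡ 1≤n =
  contradiction (≤-trans 1≤n (≤-trans (m≤n+m n (q * l)) (≤-reflexive (trans (sym am≡) (*-zeroʳ a))))) (<-irrefl refl)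
plus-m-positive {m = suc _} _ _ = s≤s z≤n

minus-l-positive : ∀ {a q m n l} → a * m + n ≡ q * l → 1 ≤ n → 1 ≤ l
minus-l-positive {a} {q} {m} {n} {zero} am+n≡ 1≤n =
  contradiction (≤-trans 1≤n (≤-trans (m≤n+m n (a * m)) (≤-reflexive (trans am+n≡ (*-zeroʳ q))))) (<-irrefl refl)
minus-l-positive {l = suc _} _ _ = s≤s z≤n

minus-m-positive : ∀ {a q m n l} → a < q → a * m + n ≡ q * l → 1 ≤ l → l * n < a → 1 ≤ m
minus-m-positive {a} {q} {zero} {n} {l} a<q am+n≡ 1≤l ln<a = contradiction (begin-strict
  q          ≤⟨ m≤m*n q l {{ℕ.>-nonZero 1≤l}} ⟩
  q * l      ≡⟨ sym am+n≡ ⟩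
  a * 0 + n  ≡⟨ cong (_+ n) (*-zeroʳ a) ⟩
  n          <⟨ factor-right 1≤l ln<a ⟩
  a          <⟨ a<q ⟩
  q          ∎) (<-irrefl refl)
  where open ≤-Reasoning
minus-m-positive {m = suc _} _ _ _ _ = s≤s z≤n

module Reciprocity (a q : ℕ) .{{_ : NonZero a}} .{{_ : NonZero q}} (a<q : a < q) where

  open TripleCounts a q a<q
  open Transfer a q

  -- The triples of S(a/q) with quotient 0 are (m , a m , 0) with a m² < q.
  quotient-zero-count : #T ((Plus? a q ∩? UnderMN? q) ∩? QuotientZero? q) q ≡ √-count a q
  quotient-zero-count = count-bijection ((Plus? a q ∩? UnderMN? q) ∩? QuotientZero? q) (Square? a q)
    proj₁ g (triples q) (upTo q) (triples-unique q) (upTo-unique q) f-maps g-maps gf (λ _ _ → refl)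
    where
    g : ℕ → Triple
    g m = m , a * m , 0
    n≡am : ∀ {m n} → a * m ≡ q * 0 + n → n ≡ a * m
    n≡am {m} {n} am≡ = sym (trans am≡ (cong (_+ n) (*-zeroʳ q)))
    m·am : ∀ m → m * (a * m) ≡ a * (m * m)
    m·am m = trans (sym (*-assoc m a m)) (trans (cong (_* m) (*-comm m a)) (*-assoc a m m))
    f-maps : ∀ {t} → t ∈ triples q → ((Plus a q ∩ UnderMN q) ∩ QuotientZero q) t →
             proj₁ t ∈ upTo q × Square a q (proj₁ t)
    f-maps {m , n , .0} t∈ ((am≡ , 1≤m , _ , mn<q) , refl) =
      ∈-upTo⁺ (proj₁ (∈-triples⁻ q t∈)) , 1≤m , subst (_< q) (trans (cong (m *_) (n≡am am≡)) (m·am m)) mn<q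
    g-maps : ∀ {m} → m ∈ upTo q → Square a q m → g m ∈ triples q × ((Plus a q ∩ UnderMN q) ∩ QuotientZero q) (g m)
    g-maps {m} m∈ (1≤m , am²<q) =
      ∈-triples⁺ (∈-upTo⁻ m∈) am<q (≤-<-trans z≤n a<q) ,
      (sym (cong (_+ a * m) (*-zeroʳ q)) , 1≤m , 1≤am , subst (_< q) (sym (m·am m)) am²<q) , refl
      where
      am<q : a * m < q
      am<q = ≤-<-trans (*-monoʳ-≤ a (m≤m*n m m {{ℕ.>-nonZero 1≤m}})) am²<q
      1≤am : 1 ≤ a * m
      1≤am = ≤-trans 1≤m (m≤n*m m a)
    gf : ∀ {t} → t ∈ triples q → ((Plus a q ∩ UnderMN q) ∩ QuotientZero q) t → g (proj₁ t) ≡ t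
    gf {m , n , .0} _ ((am≡ , _) , refl) = cong (λ u → m , u , 0) (sym (n≡am am≡))

  positive-quotient : #T ((Plus? a q ∩? UnderMN? q) ∩? ∁? (QuotientZero? q)) q
                    ≡ #T ((Plus? a q ∩? UnderLN? a) ∩? MNBelow? q) q
  positive-quotient = count-cong _ _ (triples q) forward backward
    where
    forward : ∀ {t} → t ∈ triples q → ((Plus a q ∩ UnderMN q) ∩ ∁ (QuotientZero q)) t →
            ((Plus a q ∩ UnderLN a) ∩ MNBelow q) t
    forward {m , n , zero}  _ ((_ , _) , l≢0) = contradiction refl l≢0
    forward {m , n , suc l} _ ((am≡ , _ , 1≤n , mn<q) , _) = (am≡ , s≤s z≤n , 1≤n , plus-LNBelow am≡ mn<q) , mn<q
    backward : ∀ {t} → t ∈ triples q → ((Plus a q ∩ UnderLN a) ∩ MNBelow q) t →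
           ((Plus a q ∩ UnderMN q) ∩ ∁ (QuotientZero q)) t
    backward {m , n , l} _ ((am≡ , 1≤l , 1≤n , _) , mn<q) =
      (am≡ , plus-m-positive {a} {q} am≡ 1≤n , 1≤n , mn<q) , λ l≡0 → contradiction (subst (1 ≤_) l≡0 1≤l) λ ()

  plus-reciprocity : Sᶻ (+ a) q + #T (N⁺? a q) q ≡ √-count a q + Sᶻ (ℤ.- + q) a
  plus-reciprocity = begin
    Sᶻ (+ a) q + #N⁺
      ≡⟨ cong (_+ #N⁺) (trans S⁺-as-triples (count-split P⁺? (QuotientZero? q) (triples q))) ⟩
    (#T (P⁺? ∩? QuotientZero? q) q + #T (P⁺? ∩? ∁? (QuotientZero? q)) q) + #N⁺
      ≡⟨ cong₂ (λ u v → (u + v) + #N⁺) quotient-zero-count positive-quotient ⟩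
    (√-count a q + #T (P⁻? ∩? MNBelow? q) q) + #N⁺
      ≡⟨ +-assoc (√-count a q) _ #N⁺ ⟩
    √-count a q + (#T (P⁻? ∩? MNBelow? q) q + #N⁺)
      ≡⟨ cong (λ u → √-count a q + u) (sym (trans S⁻-recip-as-triples (count-split P⁻? (MNBelow? q) (triples q)))) ⟩
    √-count a q + Sᶻ (ℤ.- + q) a
      ∎
    where
    open ≡-Reasoning
    P⁺? : Decidable (Plus a q ∩ UnderMN q)
    P⁺? = Plus? a q ∩? UnderMN? q
    P⁻? : Decidable (Plus a q ∩ UnderLN a)
    P⁻? = Plus? a q ∩? UnderLN? a
    #N⁺ : ℕ
    #N⁺ = #T (N⁺? a q) q

  small-ln : #T ((Minus? a q ∩? UnderMN? q) ∩? LNBelow? a) q ≡ #T (Minus? a q ∩? UnderLN? a) q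
  small-ln = count-cong _ _ (triples q) forward backward
    where
    forward : ∀ {t} → t ∈ triples q → ((Minus a q ∩ UnderMN q) ∩ LNBelow a) t → (Minus a q ∩ UnderLN a) t
    forward {m , n , l} _ ((am+n≡ , _ , 1≤n , _) , ln<a) = am+n≡ , minus-l-positive {a} {q} am+n≡ 1≤n , 1≤n , ln<a
    backward : ∀ {t} → t ∈ triples q → (Minus a q ∩ UnderLN a) t → ((Minus a q ∩ UnderMN q) ∩ LNBelow a) t
    backward {m , n , l} _ (am+n≡ , 1≤l , 1≤n , ln<a) =
      (am+n≡ , minus-m-positive a<q am+n≡ 1≤l ln<a , 1≤n , minus-MNBelow am+n≡ ln<a) , ln<a

  minus-reciprocity : Sᶻ (ℤ.- + a) q ≡ Sᶻ (+ q) a + #T (N⁻? a q) q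
  minus-reciprocity = begin
    Sᶻ (ℤ.- + a) q
      ≡⟨ trans S⁻-as-triples (count-split (Minus? a q ∩? UnderMN? q) (LNBelow? a) (triples q)) ⟩
    #T ((Minus? a q ∩? UnderMN? q) ∩? LNBelow? a) q + #T (N⁻? a q) q
      ≡⟨ cong (_+ #T (N⁻? a q) q) (trans small-ln (sym S⁺-recip-as-triples)) ⟩
    Sᶻ (+ q) a + #T (N⁻? a q) q
      ∎
    where open ≡-Reasoning

module SquareRootCount (a q : ℕ) .{{_ : NonZero a}} where

  A : ℕ
  A = √-count a q

  square-mono : ∀ {x y} → x ≤ y → a * (x * x) ≤ a * (y * y)
  square-mono x≤y = *-monoʳ-≤ a (*-mono-≤ x≤y x≤y)

  -- If every counted m is at most b then A ≤ b: m ↦ m − 1 injects into [0, b).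
  count-≤ : ∀ b → (∀ {m} → Square a q m → m ≤ b) → A ≤ b
  count-≤ b bounded = subst (A ≤_) (length-upTo b)
    (count-≤-length (Square? a q) pred (upTo q) (upTo b) (upTo-unique q) maps inj)
    where
    maps : ∀ {m} → m ∈ upTo q → Square a q m → pred m ∈ upTo b
    maps {suc m} _ sq = ∈-upTo⁺ (bounded sq)
    inj : ∀ {m m′} → m ∈ upTo q → m′ ∈ upTo q → Square a q m → Square a q m′ → pred m ≡ pred m′ → m ≡ m′
    inj {suc m} {suc m′} _ _ _ _ m≡m′ = cong suc m≡m′

  -- If every m with 1 ≤ m ≤ b is counted then b ≤ A: i ↦ i + 1 injects [0, b) into the set.
  count-≥ : ∀ b → (∀ {m} → 1 ≤ m → m ≤ b → Square a q m) → b ≤ A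
  count-≥ b all-counted = subst (_≤ A) (trans (count-always (upTo b)) (length-upTo b))
    (count-injection always (Square? a q) suc (upTo b) (upTo q) (upTo-unique b) maps (λ _ _ _ _ → suc-injective))
    where
    maps : ∀ {i} → i ∈ upTo b → ⊤ → suc i ∈ upTo q × Square a q (suc i)
    maps {i} i∈ _ = ∈-upTo⁺ (≤-<-trans (m≤n*m (suc i) a) (≤-<-trans (*-monoʳ-≤ a (m≤m*n (suc i) (suc i))) sq)) ,
                    counted
      where
      counted : Square a q (suc i)
      counted = all-counted (s≤s z≤n) (∈-upTo⁻ i∈)
      sq : a * (suc i * suc i) < q
      sq = proj₂ counted

  -- Otherwise every counted m is below A, so A ≤ A − 1, i.e. A = 0; but a · 0² ≤ q.
  √-count-lower : a * (A * A) ≤ q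
  √-count-lower with a * (A * A) ≤? q
  ... | yes ok = ok
  ... | no aA²≰q = contradiction (subst (λ A → q < a * (A * A)) A≡0 q<aA²) λ q<a·0 → n≮0 (<-≤-trans q<a·0 (≤-reflexive (*-zeroʳ a)))
    where
    q<aA² : q < a * (A * A)
    q<aA² = ≰⇒> aA²≰q
    below-A : ∀ {m} → Square a q m → m ≤ pred A
    below-A {m} (_ , am²<q) with m <? A
    ... | yes m<A = suc[m]≤n⇒m≤pred[n] m<A
    ... | no m≮A = contradiction (<-≤-trans (<-trans am²<q q<aA²) (square-mono (≮⇒≥ m≮A))) (<-irrefl refl)
    A≡0 : A ≡ 0
    A≡0 with A | count-≤ (pred A) below-A
    ... | zero  | _ = refl
    ... | suc k | k+1≤k = contradiction k+1≤k (<-irrefl refl)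

  -- Otherwise all of 1, …, A + 1 are counted, so A + 1 ≤ A.
  √-count-upper : q ≤ a * (suc A * suc A)
  √-count-upper with q ≤? a * (suc A * suc A)
  ... | yes ok = ok
  ... | no q≰ = contradiction (count-≥ (suc A) counted) (<-irrefl refl)
    where
    counted : ∀ {m} → 1 ≤ m → m ≤ suc A → Square a q m
    counted 1≤m m≤A+1 = 1≤m , ≤-<-trans (square-mono m≤A+1) (≰⇒> q≰)

-- m + j ≤ m j + 1 for m, j ≥ 1, and m + j ≤ m j for m, j ≥ 2, since (m − 1)(j − 1) ≥ 0, resp. ≥ 1.
sum≤product+1 : ∀ m j → 1 ≤ m → 1 ≤ j → m + j ≤ m * j + 1
sum≤product+1 (suc m) (suc j) _ _ = subst (suc m + suc j ≤_) (sym (expand m j)) (m≤m+n _ _)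
  where
  expand : ∀ m j → suc m * suc j + 1 ≡ (suc m + suc j) + m * j
  expand = ℕ-Solver.solve-∀

sum≤product : ∀ m j → 2 ≤ m → 2 ≤ j → m + j ≤ m * j
sum≤product (suc (suc m)) (suc (suc j)) _ _ = subst (suc (suc m) + suc (suc j) ≤_) (sym (expand m j)) (m≤m+n _ _)
  where
  expand : ∀ m j → suc (suc m) * suc (suc j) ≡ (suc (suc m) + suc (suc j)) + (m + j + m * j)
  expand = ℕ-Solver.solve-∀
sum≤product (suc zero) _ (s≤s ()) _
sum≤product (suc (suc _)) (suc zero) _ (s≤s ())

Beyond OnLine : ℕ → Triple → Set
Beyond c (m , n , l) = c * l < m
OnLine c (m , n , l) = m ≡ c * l

Beyond? : ∀ c → Decidable (Beyond c)
Beyond? c (m , n , l) = c * l <? m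
OnLine? : ∀ c → Decidable (OnLine c)
OnLine? c (m , n , l) = m ≟ c * l

-- With multiplier 0 there are no defects: l n < 0 is impossible for N⁺, and for N⁻
-- the equation n = a l with n ≥ 1 forces m n ≥ n ≥ a.
N⁺-zero : ∀ a B → #T (N⁺? 0 a) B ≡ 0
N⁺-zero a B = count-none (N⁺? 0 a) (triples B) λ { {m , n , l} _ ((_ , _ , _ , ()) , _) }

N⁻-zero : ∀ a B → #T (N⁻? 0 a) B ≡ 0
N⁻-zero a B = count-none (N⁻? 0 a) (triples B) empty
  where
  empty : ∀ {t} → t ∈ triples B → ¬ N⁻ 0 a t
  empty {m , n , zero}  _ ((n≡a·0 , _ , 1≤n , _) , _) = contradiction (trans n≡a·0 (*-zeroʳ a)) (≢-sym (<⇒≢ 1≤n))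
  empty {m , n , suc l} _ ((n≡a+al , 1≤m , _ , mn<a) , _) = contradiction mn<a (≤⇒≯ (begin
    a              ≤⟨ m≤m*n a (suc l) ⟩
    a * suc l      ≡⟨ sym n≡a+al ⟩
    n              ≤⟨ m≤n*m n m {{ℕ.>-nonZero 1≤m}} ⟩
    m * n          ∎))
    where open ≤-Reasoning

module EuclideanStep (a q c r : ℕ) .{{_ : NonZero a}} (q≡ca+r : q ≡ c * a + r) (r<a : r < a) (1≤c : 1 ≤ c) where

  plus-step : ∀ {m n l} → a * m ≡ q * l + n → c * l ≤ m × a * (m ∸ c * l) ≡ r * l + n
  plus-step {m} {n} {l} am≡ = cl≤m , (begin
    a * (m ∸ c * l)              ≡⟨ *-distribˡ-∸ a m (c * l) ⟩
    a * m ∸ a * (c * l)          ≡⟨ cong (_∸ a * (c * l)) am≡′ ⟩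
    a * (c * l) + (r * l + n) ∸ a * (c * l) ≡⟨ m+n∸m≡n (a * (c * l)) (r * l + n) ⟩
    r * l + n                    ∎)
    where
    open ≡-Reasoning
    expand : ∀ a c r l n → (c * a + r) * l + n ≡ a * (c * l) + (r * l + n)
    expand = ℕ-Solver.solve-∀
    am≡′ : a * m ≡ a * (c * l) + (r * l + n)
    am≡′ = trans am≡ (trans (cong (λ u → u * l + n) q≡ca+r) (expand a c r l n))
    cl≤m : c * l ≤ m
    cl≤m = *-cancelˡ-≤ a (≤-trans (m≤m+n (a * (c * l)) _) (≤-reflexive (sym am≡′)))

  minus-step : ∀ {m n l} → a * m + n ≡ q * l → a * m + n ≡ a * (c * l) + r * l
  minus-step {m} {n} {l} am+n≡ = trans am+n≡ (trans (cong (_* l) q≡ca+r) (expand a c r l))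
    where
    expand : ∀ a c r l → (c * a + r) * l ≡ a * (c * l) + r * l
    expand = ℕ-Solver.solve-∀

  relocate unrelocate : Triple → Triple
  relocate   (m , n , l) = l , n , m ∸ c * l
  unrelocate (l , n , L) = L + c * l , n , l

  N⁺-to-N⁻ : #T (N⁺? a q) q ≤ #T (N⁻? r a) a
  N⁺-to-N⁻ = count-retraction (N⁺? a q) (N⁻? r a) relocate unrelocate (triples q) (triples a) (triples-unique q)
    maps left-inverse
    where
    maps : ∀ {t} → t ∈ triples q → N⁺ a q t →
           relocate t ∈ triples a × N⁻ r a (relocate t)
    maps {m , n , l} _ ((am≡ , 1≤l , 1≤n , ln<a) , mn≮q) =
      ∈-triples⁺ l<a n<a L<a , (sym aL≡ , 1≤l , 1≤n , ln<a) , Ln≮r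
      where
      L : ℕ
      L = m ∸ c * l
      cl≤m : c * l ≤ m
      cl≤m = proj₁ (plus-step am≡)
      aL≡ : a * L ≡ r * l + n
      aL≡ = proj₂ (plus-step am≡)
      l<a : l < a
      l<a = factor-left 1≤n ln<a
      n<a : n < a
      n<a = factor-right 1≤l ln<a
      L<a : L < a
      L<a = *-cancelˡ-< a _ _ (subst (_< a * a) (sym aL≡) (digits-bound r<a l<a n<a))
      -- otherwise m n = c (l n) + L n < c a + r = q
      Ln≮r : ¬ (L * n < r)
      Ln≮r Ln<r = mn≮q (begin-strict
        m * n                ≡⟨ cong (_* n) (sym (m∸n+n≡m cl≤m)) ⟩
        (L + c * l) * n      ≡⟨ *-distribʳ-+ n L (c * l) ⟩
        L * n + c * l * n    ≡⟨ cong (λ u → L * n + u) (*-assoc c l n) ⟩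
        L * n + c * (l * n)  <⟨ +-mono-<-≤ Ln<r (*-monoʳ-≤ c (<⇒≤ ln<a)) ⟩
        r + c * a            ≡⟨ +-comm r (c * a) ⟩
        c * a + r            ≡⟨ sym q≡ca+r ⟩
        q                    ∎)
        where open ≤-Reasoning
    left-inverse : ∀ {t} → t ∈ triples q → N⁺ a q t → unrelocate (relocate t) ≡ t
    left-inverse {m , n , l} _ ((am≡ , _) , _) = cong (λ u → u , n , l) (m∸n+n≡m (proj₁ (plus-step am≡)))

  OnLineDefect : Triple → Set
  OnLineDefect = (N⁻ a q ∩ ∁ (Beyond c)) ∩ OnLine c

  OnLine⁻? : Decidable OnLineDefect
  OnLine⁻? = (N⁻? a q ∩? ∁? (Beyond? c)) ∩? OnLine? c

  InsideDefect : Triple → Set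
  InsideDefect = (N⁻ a q ∩ ∁ (Beyond c)) ∩ ∁ (OnLine c)

  Inside⁻? : Decidable InsideDefect
  Inside⁻? = (N⁻? a q ∩? ∁? (Beyond? c)) ∩? ∁? (OnLine? c)

  N⁻-split : #T (N⁻? a q) q ≡ #T (N⁻? a q ∩? Beyond? c) q + (#T OnLine⁻? q + #T Inside⁻? q)
  N⁻-split = trans (count-split (N⁻? a q) (Beyond? c) (triples q))
                   (cong (λ u → #T (N⁻? a q ∩? Beyond? c) q + u) (count-split (N⁻? a q ∩? ∁? (Beyond? c)) (OnLine? c) (triples q)))

  beyond-step : ∀ {m n l} → N⁻ a q (m , n , l) → c * l < m →
                1 ≤ m ∸ c * l × (m ∸ c * l) * n < r × r * l ≡ a * (m ∸ c * l) + n
  beyond-step {m} {n} {l} ((am+n≡ , 1≤m , 1≤n , mn<q) , ln≮a) cl<m = 1≤L , Ln<r , sym aL+n≡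
    where
    L : ℕ
    L = m ∸ c * l
    1≤L : 1 ≤ L
    1≤L = m<n⇒0<n∸m cl<m
    aL+n≡ : a * L + n ≡ r * l
    aL+n≡ = +-cancelˡ-≡ (a * (c * l)) _ _ (begin
      a * (c * l) + (a * L + n)  ≡⟨ sym (+-assoc (a * (c * l)) (a * L) n) ⟩
      a * (c * l) + a * L + n    ≡⟨ cong (_+ n) (sym (*-distribˡ-+ a (c * l) L)) ⟩
      a * (c * l + L) + n        ≡⟨ cong (λ u → a * u + n) (m+[n∸m]≡n (<⇒≤ cl<m)) ⟩
      a * m + n                  ≡⟨ minus-step am+n≡ ⟩
      a * (c * l) + r * l        ∎)
      where open ≡-Reasoning
    -- otherwise q = c a + r ≤ c (l n) + L n = m n
    Ln<r : L * n < r
    Ln<r with L * n <? r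
    ... | yes Ln<r = Ln<r
    ... | no Ln≮r = contradiction mn<q (≤⇒≯ (begin
      q                    ≡⟨ q≡ca+r ⟩
      c * a + r            ≤⟨ +-mono-≤ (*-monoʳ-≤ c (≮⇒≥ ln≮a)) (≮⇒≥ Ln≮r) ⟩
      c * (l * n) + L * n  ≡⟨ cong (_+ L * n) (sym (*-assoc c l n)) ⟩
      c * l * n + L * n    ≡⟨ sym (*-distribʳ-+ n (c * l) L) ⟩
      (c * l + L) * n      ≡⟨ cong (_* n) (m+[n∸m]≡n (<⇒≤ cl<m)) ⟩
      m * n                ∎))
      where open ≤-Reasoning

  beyond-to-N⁺ : #T (N⁻? a q ∩? Beyond? c) q ≤ #T (N⁺? r a) a
  beyond-to-N⁺ = count-retraction (N⁻? a q ∩? Beyond? c) (N⁺? r a) relocate unrelocate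
    (triples q) (triples a) (triples-unique q) maps left-inverse
    where
    maps : ∀ {t} → t ∈ triples q → (N⁻ a q ∩ Beyond c) t →
           relocate t ∈ triples a × N⁺ r a (relocate t)
    maps {m , n , l} _ (defect@((_ , _ , 1≤n , _) , ln≮a) , cl<m) =
      ∈-triples⁺ l<a (<-trans n<r r<a) (<-trans L<r r<a) , (rl≡ , 1≤L , 1≤n , Ln<r) , ln≮a
      where
      L : ℕ
      L = m ∸ c * l
      step : 1 ≤ L × L * n < r × r * l ≡ a * L + n
      step = beyond-step defect cl<m
      1≤L : 1 ≤ L
      1≤L = proj₁ step
      Ln<r : L * n < r
      Ln<r = proj₁ (proj₂ step)
      rl≡ : r * l ≡ a * L + n
      rl≡ = proj₂ (proj₂ step)
      L<r : L < r
      L<r = factor-left 1≤n Ln<r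
      n<r : n < r
      n<r = factor-right 1≤L Ln<r
      l<a : l < a
      l<a = *-cancelˡ-< r _ _ (begin-strict
        r * l      ≡⟨ rl≡ ⟩
        a * L + n  <⟨ +-monoʳ-< (a * L) (<-trans n<r r<a) ⟩
        a * L + a  ≡⟨ trans (+-comm (a * L) a) (sym (*-suc a L)) ⟩
        a * suc L  ≤⟨ *-monoʳ-≤ a L<r ⟩
        a * r      ≡⟨ *-comm a r ⟩
        r * a      ∎)
        where open ≤-Reasoning
    left-inverse : ∀ {t} → t ∈ triples q → (N⁻ a q ∩ Beyond c) t →
           unrelocate (relocate t) ≡ t
    left-inverse {m , n , l} _ (_ , cl<m) = cong (λ u → u , n , l) (m∸n+n≡m (<⇒≤ cl<m))

  on-line-n : ∀ {m n l} → a * m + n ≡ q * l → m ≡ c * l → n ≡ r * l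
  on-line-n {n = n} {l} am+n≡ refl = +-cancelˡ-≡ (a * (c * l)) n (r * l) (minus-step am+n≡)

  -- Two defect triples (c l , r l , l) and (c l′ , r l′ , l′) on the line with l < l′ cannot
  -- coexist: q = r + c a ≤ c r (1 + l²) ≤ (c l′)(r l′), contradicting m n < q for the second.
  on-line-incompatible : ∀ {l l′} → l < l′ → a ≤ l * (r * l) → (c * l′) * (r * l′) < q → ⊥
  on-line-incompatible {l} {l′} l<l′ a≤lrl cl′rl′<q = contradiction cl′rl′<q (≤⇒≯ (begin
    q                          ≡⟨ trans q≡ca+r (+-comm (c * a) r) ⟩
    r + c * a                  ≤⟨ +-monoˡ-≤ (c * a) (m≤n*m r c {{ℕ.>-nonZero 1≤c}}) ⟩
    c * r + c * a              ≡⟨ sym (*-distribˡ-+ c r a) ⟩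
    c * (r + a)                ≤⟨ *-monoʳ-≤ c (+-monoʳ-≤ r (subst (a ≤_) (regroup₁ l r) a≤lrl)) ⟩
    c * (r + r * (l * l))      ≡⟨ cong (c *_) (sym (*-suc r (l * l))) ⟩
    c * (r * suc (l * l))      ≤⟨ *-monoʳ-≤ c (*-monoʳ-≤ r (*-mono-< l<l′ l<l′)) ⟩
    c * (r * (l′ * l′))        ≡⟨ regroup₂ c r l′ ⟩
    (c * l′) * (r * l′)        ∎))
    where
    open ≤-Reasoning
    regroup₁ : ∀ l r → l * (r * l) ≡ r * (l * l)
    regroup₁ = ℕ-Solver.solve-∀
    regroup₂ : ∀ c r l → c * (r * (l * l)) ≡ (c * l) * (r * l)
    regroup₂ = ℕ-Solver.solve-∀

  on-line-≤1 : #T OnLine⁻? q ≤ 1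
  on-line-≤1 = count-≤-length OnLine⁻? (λ _ → 0) (triples q) (0 ∷ []) (triples-unique q) (λ _ _ → here refl) unique
    where
    unique : ∀ {t t′} → t ∈ triples q → t′ ∈ triples q → OnLineDefect t → OnLineDefect t′ → 0 ≡ 0 → t ≡ t′
    unique {m , n , l} {m′ , n′ , l′} _ _
      ((((am+n≡ , _ , _ , mn<q) , ln≮a) , _) , m≡cl) ((((am′+n′≡ , _ , _ , m′n′<q) , l′n′≮a) , _) , m′≡cl′) _
      with on-line-n am+n≡ m≡cl | on-line-n am′+n′≡ m′≡cl′ | m≡cl | m′≡cl′ | <-cmp l l′
    ... | refl | refl | refl | refl | tri< l<l′ _ _ = ⊥-elim (on-line-incompatible l<l′ (≮⇒≥ ln≮a) m′n′<q)
    ... | refl | refl | refl | refl | tri≈ _ refl _ = refl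
    ... | refl | refl | refl | refl | tri> _ _ l′<l = ⊥-elim (on-line-incompatible l′<l (≮⇒≥ l′n′≮a) mn<q)

  -- For r = 0 no defect triple lies on the line, since there n = r l = 0.
  on-line-empty : r ≡ 0 → #T OnLine⁻? q ≡ 0
  on-line-empty r≡0 = count-none OnLine⁻? (triples q) empty
    where
    empty : ∀ {t} → t ∈ triples q → ¬ OnLineDefect t
    empty {m , n , l} _ ((((am+n≡ , _ , 1≤n , _) , _) , _) , m≡cl) =
      contradiction (trans (on-line-n am+n≡ m≡cl) (cong (_* l) r≡0)) (≢-sym (<⇒≢ 1≤n))

  -- For a defect triple with m < c l put j = c l − m ≥ 1.  Then n = a j + r l, so c ≤ m j would
  -- give q = c a + r ≤ a m j + r m l = m n, contradicting m n < q: hence m j < c.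
  inside-product : ∀ {m n l} → N⁻ a q (m , n , l) → m < c * l → m * (c * l ∸ m) < c
  inside-product {m} {n} {l} ((am+n≡ , 1≤m , 1≤n , mn<q) , _) m<cl = ≰⇒> c≰mj
    where
    j : ℕ
    j = c * l ∸ m
    1≤l : 1 ≤ l
    1≤l = minus-l-positive {a} {q} am+n≡ 1≤n
    n≡aj+rl : n ≡ a * j + r * l
    n≡aj+rl = +-cancelˡ-≡ (a * m) _ _ (begin
      a * m + n                ≡⟨ minus-step am+n≡ ⟩
      a * (c * l) + r * l      ≡⟨ cong (λ u → a * u + r * l) (sym (m+[n∸m]≡n (<⇒≤ m<cl))) ⟩
      a * (m + j) + r * l      ≡⟨ cong (_+ r * l) (*-distribˡ-+ a m j) ⟩
      a * m + a * j + r * l    ≡⟨ +-assoc (a * m) (a * j) (r * l) ⟩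
      a * m + (a * j + r * l)  ∎)
      where open ≡-Reasoning
    c≰mj : ¬ (c ≤ m * j)
    c≰mj c≤mj = contradiction mn<q (≤⇒≯ (begin
      q                          ≡⟨ trans q≡ca+r (cong (_+ r) (*-comm c a)) ⟩
      a * c + r                  ≤⟨ +-mono-≤ (*-monoʳ-≤ a c≤mj) (m≤m*n r (m * l) {{ℕ.>-nonZero (*-mono-≤ 1≤m 1≤l)}}) ⟩
      a * (m * j) + r * (m * l)  ≡⟨ regroup a m j r l ⟩
      m * (a * j + r * l)        ≡⟨ cong (m *_) (sym n≡aj+rl) ⟩
      m * n                      ∎))
      where
      open ≤-Reasoning
      regroup : ∀ a m j r l → a * (m * j) + r * (m * l) ≡ m * (a * j + r * l)
      regroup = ℕ-Solver.solve-∀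

  -- A defect triple with m < c l has l = 1 and m ∈ {1, c − 1}: with j = c l − m, l ≥ 2 would give
  -- c + 1 ≤ c l = m + j ≤ m j + 1, and for l = 1, m + j = c with m, j ≥ 2 would give c ≤ m j.
  inside-shape : ∀ {m n l} → N⁻ a q (m , n , l) → m < c * l → l ≡ 1 × (m ≡ 1 ⊎ m ≡ c ∸ 1)
  inside-shape {m} {n} {l} defect@((am+n≡ , 1≤m , 1≤n , _) , _) m<cl = l≡1 , m≡1⊎m≡c-1
    where
    j : ℕ
    j = c * l ∸ m
    m+j≡cl : m + j ≡ c * l
    m+j≡cl = m+[n∸m]≡n (<⇒≤ m<cl)
    1≤j : 1 ≤ j
    1≤j = m<n⇒0<n∸m m<cl
    mj<c : m * j < c
    mj<c = inside-product defect m<cl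
    l≡1 : l ≡ 1
    l≡1 with l ≟ 1
    ... | yes l≡1 = l≡1
    ... | no l≢1 = contradiction mj<c (≤⇒≯ (+-cancelˡ-≤ 1 _ _ (subst (_≤ 1 + m * j) (+-comm c 1) (begin
      c + 1      ≤⟨ +-monoʳ-≤ c 1≤c ⟩
      c + c      ≡⟨ cong (λ u → c + u) (sym (*-identityʳ c)) ⟩
      c + c * 1  ≡⟨ sym (*-suc c 1) ⟩
      c * 2      ≤⟨ *-monoʳ-≤ c (≤∧≢⇒< (minus-l-positive {a} {q} am+n≡ 1≤n) (≢-sym l≢1)) ⟩
      c * l      ≡⟨ sym m+j≡cl ⟩
      m + j      ≤⟨ sum≤product+1 m j 1≤m 1≤j ⟩
      m * j + 1  ≡⟨ +-comm (m * j) 1 ⟩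
      1 + m * j  ∎))))
      where open ≤-Reasoning
    m+j≡c : m + j ≡ c
    m+j≡c = trans m+j≡cl (trans (cong (c *_) l≡1) (*-identityʳ c))
    m≡1⊎m≡c-1 : m ≡ 1 ⊎ m ≡ c ∸ 1
    m≡1⊎m≡c-1 with m ≟ 1 | j ≟ 1
    ... | yes m≡1 | _       = inj₁ m≡1
    ... | no _    | yes j≡1 = inj₂ (sym (trans (cong (_∸ 1) (trans (sym m+j≡c) (cong (λ u → m + u) j≡1))) (m+n∸n≡m m 1)))
    ... | no m≢1  | no j≢1  = contradiction mj<c (≤⇒≯ (subst (_≤ m * j) m+j≡c
                                (sum≤product m j (≤∧≢⇒< 1≤m (≢-sym m≢1)) (≤∧≢⇒< 1≤j (≢-sym j≢1)))))

  inside-≤2 : #T Inside⁻? q ≤ 2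
  inside-≤2 = count-≤-length Inside⁻? proj₁ (triples q) (1 ∷ c ∸ 1 ∷ []) (triples-unique q) maps unique
    where
    m<cl : ∀ {m n l} → InsideDefect (m , n , l) → m < c * l
    m<cl ((_ , cl≮m) , m≢cl) = ≤∧≢⇒< (≮⇒≥ cl≮m) m≢cl
    maps : ∀ {t} → t ∈ triples q → InsideDefect t → proj₁ t ∈ 1 ∷ c ∸ 1 ∷ []
    maps {m , n , l} _ inside@((defect , _) , _) with proj₂ (inside-shape defect (m<cl inside))
    ... | inj₁ m≡1   = here m≡1
    ... | inj₂ m≡c-1 = there (here m≡c-1)
    unique : ∀ {t t′} → t ∈ triples q → t′ ∈ triples q → InsideDefect t → InsideDefect t′ → proj₁ t ≡ proj₁ t′ → t ≡ t′
    unique {m , n , l} {.m , n′ , l′} _ _ inside@((defect@((am+n≡ , _) , _) , _) , _) inside′@((defect′@((am+n′≡ , _) , _) , _) , _) refl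
      with proj₁ (inside-shape defect (m<cl inside)) | proj₁ (inside-shape defect′ (m<cl inside′))
    ... | refl | refl = cong (λ u → m , u , 1) (+-cancelˡ-≡ (a * m) n n′ (trans am+n≡ (sym am+n′≡)))

  N⁻-to-N⁺ : #T (N⁻? a q) q ≤ #T (N⁺? r a) a + 3
  N⁻-to-N⁺ = begin
    #T (N⁻? a q) q                                                  ≡⟨ N⁻-split ⟩
    #T (N⁻? a q ∩? Beyond? c) q + (#T OnLine⁻? q + #T Inside⁻? q)  ≤⟨ +-mono-≤ beyond-to-N⁺ (+-mono-≤ on-line-≤1 inside-≤2) ⟩
    #T (N⁺? r a) a + 3                                              ∎
    where open ≤-Reasoning

  N⁺-last : r ≡ 0 → #T (N⁺? a q) q ≡ 0
  N⁺-last refl = n≤0⇒n≡0 (subst (#T (N⁺? a q) q ≤_) (N⁻-zero a a) N⁺-to-N⁻)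

  N⁻-last : r ≡ 0 → #T (N⁻? a q) q ≤ 2
  N⁻-last refl = begin
    #T (N⁻? a q) q                                                  ≡⟨ N⁻-split ⟩
    #T (N⁻? a q ∩? Beyond? c) q + (#T OnLine⁻? q + #T Inside⁻? q)  ≤⟨ +-mono-≤ beyond-to-N⁺ (+-monoˡ-≤ _ (≤-reflexive (on-line-empty refl))) ⟩
    #T (N⁺? 0 a) a + (0 + #T Inside⁻? q)                            ≡⟨ cong (_+ #T Inside⁻? q) (N⁺-zero a a) ⟩
    #T Inside⁻? q                                                   ≤⟨ inside-≤2 ⟩
    2                                                               ∎
    where open ≤-Reasoning

steps-fuel : ∀ f f′ x y → y < f → y < f′ → stepsAux f x y ≡ stepsAux f′ x y
steps-fuel (suc f) (suc f′) x zero    _         _          = refl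
steps-fuel (suc f) (suc f′) x (suc y) (s≤s y<f) (s≤s y<f′) =
  cong suc (steps-fuel f f′ (suc y) (x % suc y) (<-≤-trans (m%n<n x (suc y)) y<f) (<-≤-trans (m%n<n x (suc y)) y<f′))

euclidSteps-step : ∀ q a .{{_ : NonZero a}} → euclidSteps q a ≡ suc (euclidSteps a (q % a))
euclidSteps-step q (suc a) = cong suc (steps-fuel (suc a) (suc (q % suc a)) (suc a) (q % suc a) (m%n<n q (suc a)) ≤-refl)

division-identity : ∀ q a .{{_ : NonZero a}} → q ≡ (q ℕ./ a) * a + q % a
division-identity q a = trans (m≡m%n+[m/n]*n q a) (+-comm (q % a) _)

DefectBounds : ℕ → ℕ → ℕ → Set
DefectBounds a q k = 2 * #T (N⁻? a q) q ≤ 3 * k + 1 × 2 * #T (N⁺? a q) q + 2 ≤ 3 * k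

-- One more step costs 3/2 in each bound: 2 (x + 3) ≤ 3 (k + 1) + 1 and 2 x + 2 ≤ 3 (k + 1).
N⁻-budget : ∀ x y k → x ≤ y + 3 → 2 * y + 2 ≤ 3 * k → 2 * x ≤ 3 * suc k + 1
N⁻-budget x y k x≤y+3 h = begin
  2 * x            ≤⟨ *-monoʳ-≤ 2 x≤y+3 ⟩
  2 * (y + 3)      ≡⟨ expand₁ y ⟩
  (2 * y + 2) + 4  ≤⟨ +-monoˡ-≤ 4 h ⟩
  3 * k + 4        ≡⟨ expand₂ k ⟩
  3 * suc k + 1    ∎
  where
  open ≤-Reasoning
  expand₁ : ∀ y → 2 * (y + 3) ≡ (2 * y + 2) + 4
  expand₁ = ℕ-Solver.solve-∀
  expand₂ : ∀ k → 3 * k + 4 ≡ 3 * suc k + 1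
  expand₂ = ℕ-Solver.solve-∀

N⁺-budget : ∀ x y k → x ≤ y → 2 * y ≤ 3 * k + 1 → 2 * x + 2 ≤ 3 * suc k
N⁺-budget x y k x≤y h = begin
  2 * x + 2        ≤⟨ +-monoˡ-≤ 2 (*-monoʳ-≤ 2 x≤y) ⟩
  2 * y + 2        ≤⟨ +-monoˡ-≤ 2 h ⟩
  3 * k + 1 + 2    ≡⟨ expand k ⟩
  3 * suc k        ∎
  where
  open ≤-Reasoning
  expand : ∀ k → 3 * k + 1 + 2 ≡ 3 * suc k
  expand = ℕ-Solver.solve-∀

defect-bounds : ∀ a q → 1 ≤ a → a < q → DefectBounds a q (euclidSteps q a)
defect-bounds = <-rec (λ a → ∀ q → 1 ≤ a → a < q → DefectBounds a q (euclidSteps q a)) step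
  where
  step : ∀ a → (∀ {b} → b < a → ∀ q → 1 ≤ b → b < q → DefectBounds b q (euclidSteps q b)) →
         ∀ q → 1 ≤ a → a < q → DefectBounds a q (euclidSteps q a)
  step a@(suc _) ih q _ a<q = subst (DefectBounds a q) (sym (euclidSteps-step q a)) (bounds (q % a ≟ 0))
    where
    open EuclideanStep a q (q ℕ./ a) (q % a) (division-identity q a) (m%n<n q a) (m≥n⇒m/n>0 (<⇒≤ a<q))
    bounds : Dec (q % a ≡ 0) → DefectBounds a q (suc (euclidSteps a (q % a)))
    bounds (yes r≡0) = subst (λ r → DefectBounds a q (suc (euclidSteps a r))) (sym r≡0)
      (≤-trans (*-monoʳ-≤ 2 (N⁻-last r≡0)) (s≤s (s≤s (s≤s (s≤s z≤n)))) ,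
       subst (λ n → 2 * n + 2 ≤ 3) (sym (N⁺-last r≡0)) (s≤s (s≤s z≤n)))
    bounds (no r≢0) = N⁻-budget _ _ _ N⁻-to-N⁺ (proj₂ ih′) , N⁺-budget _ _ _ N⁺-to-N⁻ (proj₁ ih′)
      where
      ih′ : DefectBounds (q % a) a (euclidSteps a (q % a))
      ih′ = ih (m%n<n q a) a (n≢0⇒n>0 r≢0) (m%n<n q a)

-- fromℚᵘ : ℚᵘ → ℚ (normalisation) commutes with the ring operations and is monotone,
-- because toℚᵘ is an injective, order-reflecting homomorphism and toℚᵘ ∘ fromℚᵘ ≃ id.
fromℚᵘ-+ : ∀ u v → fromℚᵘ (u ℚᵘ.+ v) ≡ fromℚᵘ u ℚ.+ fromℚᵘ v
fromℚᵘ-+ u v = ℚP.toℚᵘ-injective (ℚᵘP.≃-trans (ℚP.toℚᵘ-fromℚᵘ (u ℚᵘ.+ v)) (ℚᵘP.≃-sym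
  (ℚᵘP.≃-trans (ℚP.toℚᵘ-homo-+ (fromℚᵘ u) (fromℚᵘ v)) (ℚᵘP.+-cong (ℚP.toℚᵘ-fromℚᵘ u) (ℚP.toℚᵘ-fromℚᵘ v)))))

fromℚᵘ-* : ∀ u v → fromℚᵘ (u ℚᵘ.* v) ≡ fromℚᵘ u ℚ.* fromℚᵘ v
fromℚᵘ-* u v = ℚP.toℚᵘ-injective (ℚᵘP.≃-trans (ℚP.toℚᵘ-fromℚᵘ (u ℚᵘ.* v)) (ℚᵘP.≃-sym
  (ℚᵘP.≃-trans (ℚP.toℚᵘ-homo-* (fromℚᵘ u) (fromℚᵘ v)) (ℚᵘP.*-cong (ℚP.toℚᵘ-fromℚᵘ u) (ℚP.toℚᵘ-fromℚᵘ v)))))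

fromℚᵘ-neg : ∀ u → fromℚᵘ (ℚᵘ.- u) ≡ ℚ.- fromℚᵘ u
fromℚᵘ-neg u = ℚP.toℚᵘ-injective (ℚᵘP.≃-trans (ℚP.toℚᵘ-fromℚᵘ (ℚᵘ.- u)) (ℚᵘP.≃-sym
  (ℚᵘP.≃-trans (ℚP.toℚᵘ-homo‿- (fromℚᵘ u)) (ℚᵘP.-‿cong (ℚP.toℚᵘ-fromℚᵘ u)))))

fromℚᵘ-mono-≤ : ∀ {u v} → u ℚᵘ.≤ v → fromℚᵘ u ℚ.≤ fromℚᵘ v
fromℚᵘ-mono-≤ {u} {v} u≤v = ℚP.toℚᵘ-cancel-≤
  (ℚᵘP.≤-respʳ-≃ (ℚᵘP.≃-sym (ℚP.toℚᵘ-fromℚᵘ v)) (ℚᵘP.≤-respˡ-≃ (ℚᵘP.≃-sym (ℚP.toℚᵘ-fromℚᵘ u)) u≤v))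

/-+ : ∀ i d j d′ → i / suc d ℚ.+ j / suc d′ ≡ (i ℤ.* + suc d′ ℤ.+ j ℤ.* + suc d) / (suc d ℕ.* suc d′)
/-+ i d j d′ = sym (fromℚᵘ-+ (mkℚᵘ i d) (mkℚᵘ j d′))

/-* : ∀ i d j d′ → (i / suc d) ℚ.* (j / suc d′) ≡ (i ℤ.* j) / (suc d ℕ.* suc d′)
/-* i d j d′ = sym (fromℚᵘ-* (mkℚᵘ i d) (mkℚᵘ j d′))

neg-/ : ∀ i d → ℚ.- (i / suc d) ≡ (ℤ.- i) / suc d
neg-/ i d = sym (fromℚᵘ-neg (mkℚᵘ i d))

/-≤ : ∀ i d j d′ .{{_ : NonZero d}} .{{_ : NonZero d′}} → i ℤ.* + d′ ℤ.≤ j ℤ.* + d → i / d ℚ.≤ j / d′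
/-≤ i (suc d) j (suc d′) i·d′≤j·d = fromℚᵘ-mono-≤ {mkℚᵘ i d} {mkℚᵘ j d′} (ℚᵘ.*≤* i·d′≤j·d)

/-≤-ℕ : ∀ m d n d′ .{{_ : NonZero d}} .{{_ : NonZero d′}} → m ℕ.* d′ ℕ.≤ n ℕ.* d → (+ m) / d ℚ.≤ (+ n) / d′
/-≤-ℕ m d n d′ m·d′≤n·d = /-≤ (+ m) d (+ n) d′ (subst₂ ℤ._≤_ (ℤP.pos-* m d′) (ℤP.pos-* n d) (ℤ.+≤+ m·d′≤n·d))

nat-difference : ∀ x y u v → x ℕ.+ v ≡ u ℕ.+ y → (+ x) / 1 ℚ.- (+ y) / 1 ≡ (+ u ℤ.- + v) / 1
nat-difference x y u v x+v≡u+y = begin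
  (+ x) / 1 ℚ.+ ℚ.- ((+ y) / 1)            ≡⟨ cong ((+ x) / 1 ℚ.+_) (neg-/ (+ y) 0) ⟩
  (+ x) / 1 ℚ.+ (ℤ.- + y) / 1              ≡⟨ /-+ (+ x) 0 (ℤ.- + y) 0 ⟩
  (+ x ℤ.* + 1 ℤ.+ ℤ.- + y ℤ.* + 1) / 1    ≡⟨ cong (_/ 1) numerator ⟩
  (+ u ℤ.- + v) / 1                        ∎
  where
  open ≡-Reasoning
  in-ℤ : + x ℤ.+ + v ≡ + u ℤ.+ + y
  in-ℤ = trans (sym (ℤP.pos-+ x v)) (trans (cong +_ x+v≡u+y) (ℤP.pos-+ u y))
  regroup₁ : ∀ x y v → x ℤ.* + 1 ℤ.+ ℤ.- y ℤ.* + 1 ≡ (x ℤ.+ v) ℤ.- (v ℤ.+ y)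
  regroup₁ = ℤ-Solver.solve-∀
  regroup₂ : ∀ u y v → (u ℤ.+ y) ℤ.- (v ℤ.+ y) ≡ u ℤ.- v
  regroup₂ = ℤ-Solver.solve-∀
  numerator : + x ℤ.* + 1 ℤ.+ ℤ.- + y ℤ.* + 1 ≡ + u ℤ.- + v
  numerator = trans (regroup₁ (+ x) (+ y) (+ v)) (trans (cong (ℤ._- (+ v ℤ.+ + y)) in-ℤ) (regroup₂ (+ u) (+ y) (+ v)))

half-square : ∀ X → ((+ X) / 2) ℚ.* ((+ X) / 2) ≡ (+ (X * X)) / 4
half-square X = trans (/-* (+ X) 1 (+ X) 1) (cong (_/ 4) (sym (ℤP.pos-* X X)))

four-squares : ∀ a s → a * (s * s) * 4 ≡ (2 * s) * (2 * s) * a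
four-squares = ℕ-Solver.solve-∀

half-square-above : ∀ q a s X .{{_ : NonZero a}} → q ≤ a * (s * s) → 2 * s ≤ X →
                    (+ q) / a ℚ.≤ ((+ X) / 2) ℚ.* ((+ X) / 2)
half-square-above q a s X q≤as² 2s≤X = subst ((+ q) / a ℚ.≤_) (sym (half-square X))
  (/-≤-ℕ q a (X * X) 4 (begin
    q * 4                    ≤⟨ *-monoˡ-≤ 4 q≤as² ⟩
    a * (s * s) * 4          ≡⟨ four-squares a s ⟩
    (2 * s) * (2 * s) * a    ≤⟨ *-monoˡ-≤ a (*-mono-≤ 2s≤X 2s≤X) ⟩
    X * X * a                ∎))
  where open ≤-Reasoning

half-square-below : ∀ q a s W .{{_ : NonZero a}} → a * (s * s) ≤ q → W ≤ 2 * s →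
                    ((+ W) / 2) ℚ.* ((+ W) / 2) ℚ.≤ (+ q) / a
half-square-below q a s W as²≤q W≤2s = subst (ℚ._≤ (+ q) / a) (sym (half-square W))
  (/-≤-ℕ (W * W) 4 q a (begin
    W * W * a                ≤⟨ *-monoˡ-≤ a (*-mono-≤ W≤2s W≤2s) ⟩
    (2 * s) * (2 * s) * a    ≡⟨ sym (four-squares a s) ⟩
    a * (s * s) * 4          ≤⟨ *-monoˡ-≤ 4 as²≤q ⟩
    q * 4                    ∎))
  where open ≤-Reasoning

sum-numerator : ∀ A N K → 2 * N ≤ K → (+ A ℤ.- + N) ℤ.* + 2 ℤ.+ + K ℤ.* + 1 ≡ + (2 * A + (K ∸ 2 * N))
sum-numerator A N K 2N≤K = begin
  (+ A ℤ.- + N) ℤ.* + 2 ℤ.+ + K ℤ.* + 1   ≡⟨ regroup (+ A) (+ N) (+ K) ⟩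
  + 2 ℤ.* + A ℤ.+ (+ K ℤ.- + 2 ℤ.* + N)   ≡⟨ cong₂ (λ u v → u ℤ.+ (+ K ℤ.- v)) (sym (ℤP.pos-* 2 A)) (sym (ℤP.pos-* 2 N)) ⟩
  + (2 * A) ℤ.+ (+ K ℤ.- + (2 * N))       ≡⟨ cong (λ v → + (2 * A) ℤ.+ v) (trans (ℤP.[+m]-[+n]≡m⊖n K (2 * N)) (ℤP.⊖-≥ 2N≤K)) ⟩
  + (2 * A) ℤ.+ + (K ∸ 2 * N)             ≡⟨ sym (ℤP.pos-+ (2 * A) (K ∸ 2 * N)) ⟩
  + (2 * A + (K ∸ 2 * N))                 ∎
  where
  open ≡-Reasoning
  regroup : ∀ A N K → (A ℤ.- N) ℤ.* + 2 ℤ.+ K ℤ.* + 1 ≡ + 2 ℤ.* A ℤ.+ (K ℤ.- + 2 ℤ.* N)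
  regroup = ℤ-Solver.solve-∀

difference-numerator : ∀ A N K → (+ A ℤ.- + N) ℤ.* + 2 ℤ.+ (ℤ.- + K) ℤ.* + 1 ≡ (2 * A) ⊖ (2 * N + K)
difference-numerator A N K = begin
  (+ A ℤ.- + N) ℤ.* + 2 ℤ.+ (ℤ.- + K) ℤ.* + 1   ≡⟨ regroup (+ A) (+ N) (+ K) ⟩
  + 2 ℤ.* + A ℤ.- (+ 2 ℤ.* + N ℤ.+ + K)         ≡⟨ cong₂ (λ u v → u ℤ.- (v ℤ.+ + K)) (sym (ℤP.pos-* 2 A)) (sym (ℤP.pos-* 2 N)) ⟩
  + (2 * A) ℤ.- (+ (2 * N) ℤ.+ + K)             ≡⟨ cong (λ v → + (2 * A) ℤ.- v) (sym (ℤP.pos-+ (2 * N) K)) ⟩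
  + (2 * A) ℤ.- + (2 * N + K)                   ≡⟨ ℤP.[+m]-[+n]≡m⊖n (2 * A) (2 * N + K) ⟩
  (2 * A) ⊖ (2 * N + K)                         ∎
  where
  open ≡-Reasoning
  regroup : ∀ A N K → (A ℤ.- N) ℤ.* + 2 ℤ.+ (ℤ.- K) ℤ.* + 1 ≡ + 2 ℤ.* A ℤ.- (+ 2 ℤ.* N ℤ.+ K)
  regroup = ℤ-Solver.solve-∀

-- The main estimate: if a A² ≤ q ≤ a (A+1)² (so A ≈ √(q/a)) and 2 N + 2 ≤ K, then
-- |(A − N) − √(q/a)| ≤ K/2.  Indeed (A − N) + K/2 ≥ A + 1 ≥ √(q/a), and (A − N) − K/2 ≤ A ≤ √(q/a).
sqrt-estimate : ∀ a q A N K .{{_ : NonZero a}} → a * (A * A) ≤ q → q ≤ a * (suc A * suc A) → 2 * N + 2 ≤ K →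
                DistToSqrt≤ ((+ A ℤ.- + N) / 1) ((+ q) / a) ((+ K) / 2)
sqrt-estimate a q A N K aA²≤q q≤a[A+1]² 2N+2≤K =
  (subst (ℚ.0ℚ ℚ.≤_) (sym D+B≡) (/-≤-ℕ 0 1 X 2 z≤n) ,
   subst (λ u → (+ q) / a ℚ.≤ u ℚ.* u) (sym D+B≡) (half-square-above q a (suc A) X q≤a[A+1]² 2[A+1]≤X)) ,
  lower
  where
  δ : ℤ
  δ = + A ℤ.- + N
  X : ℕ
  X = 2 * A + (K ∸ 2 * N)
  2N≤K : 2 * N ≤ K
  2N≤K = ≤-trans (m≤m+n (2 * N) 2) 2N+2≤K
  2[A+1]≤X : 2 * suc A ≤ X
  2[A+1]≤X = ≤-trans (≤-reflexive (trans (*-suc 2 A) (+-comm 2 (2 * A))))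
               (+-monoʳ-≤ (2 * A) (m+n≤o⇒m≤o∸n 2 (subst (_≤ K) (+-comm (2 * N) 2) 2N+2≤K)))
  D+B≡ : δ / 1 ℚ.+ (+ K) / 2 ≡ (+ X) / 2
  D+B≡ = trans (/-+ δ 0 (+ K) 1) (cong (_/ 2) (sum-numerator A N K 2N≤K))
  D-B≡ : δ / 1 ℚ.- (+ K) / 2 ≡ ((2 * A) ⊖ (2 * N + K)) / 2
  D-B≡ = trans (cong (δ / 1 ℚ.+_) (neg-/ (+ K) 1))
               (trans (/-+ δ 0 (ℤ.- + K) 1) (cong (_/ 2) (difference-numerator A N K)))
  lower : δ / 1 ℚ.- (+ K) / 2 ℚ.≤ ℚ.0ℚ ⊎ (δ / 1 ℚ.- (+ K) / 2) ℚ.* (δ / 1 ℚ.- (+ K) / 2) ℚ.≤ (+ q) / a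
  lower with 2 * N + K ≤? 2 * A
  ... | yes 2N+K≤2A = inj₂ (subst (λ u → u ℚ.* u ℚ.≤ (+ q) / a) (sym (trans D-B≡ (cong (_/ 2) (ℤP.⊖-≥ 2N+K≤2A))))
                        (half-square-below q a A (2 * A ∸ (2 * N + K)) aA²≤q (m∸n≤m (2 * A) (2 * N + K))))
  ... | no 2N+K≰2A = inj₁ (subst (ℚ._≤ ℚ.0ℚ) (sym (trans D-B≡ (cong (_/ 2) (ℤP.⊖-< (≰⇒> 2N+K≰2A)))))
                        (/-≤ (ℤ.- + (2 * N + K ∸ 2 * A)) 2 (+ 0) 1
                             (subst (ℤ._≤ + 0) (sym (ℤP.*-identityʳ (ℤ.- + (2 * N + K ∸ 2 * A)))) ℤP.neg-≤-pos)))

difference-estimate : ∀ x y N K → x ≡ y + N → 2 * N ≤ K → ℚ.∣ (+ x) / 1 ℚ.- (+ y) / 1 ∣ ℚ.≤ (+ K) / 2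
difference-estimate x y N K x≡y+N 2N≤K = subst (λ u → ℚ.∣ u ∣ ℚ.≤ (+ K) / 2) (sym x-y≡N)
  (subst (ℚ._≤ (+ K) / 2) (sym (ℚP.0≤p⇒∣p∣≡p (/-≤-ℕ 0 1 N 1 z≤n)))
    (/-≤-ℕ N 1 K 2 (≤-trans (≤-reflexive (*-comm N 2)) (≤-trans 2N≤K (≤-reflexive (sym (*-identityʳ K)))))))
  where
  x-y≡N : (+ x) / 1 ℚ.- (+ y) / 1 ≡ (+ N) / 1
  x-y≡N = trans (nat-difference x y N 0 (trans (+-identityʳ x) (trans x≡y+N (+-comm y N))))
                (cong (_/ 1) (ℤP.+-identityʳ (+ N)))

module ErrorTerms (a q : ℕ) .{{_ : NonZero a}} .{{_ : NonZero q}} (1≤a : 1 ≤ a) (a<q : a < q) (a⊥q : gcd a q ≡ 1) where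

  open Reciprocity a q a<q
  open SquareRootCount a q

  k : ℕ
  k = euclidSteps q a

  q⊥a : gcd q a ≡ 1
  q⊥a = trans (gcd-comm q a) a⊥q

  bounds : DefectBounds a q k
  bounds = defect-bounds a q 1≤a a<q

  -- S(a/q) − S(−q/a) = A − N⁺ with a A² ≤ q ≤ a (A+1)² and 2 N⁺ + 2 ≤ 3 k.
  E₊-estimate : DistToSqrt≤ ((+ S ((+ a) / q)) / 1 ℚ.- (+ S ((ℤ.- + q) / a)) / 1) ((+ q) / a) ((+ (3 * k + 6)) / 2)
  E₊-estimate = subst (λ D → DistToSqrt≤ D ((+ q) / a) ((+ (3 * k + 6)) / 2)) (sym difference)
    (sqrt-estimate a q A (#T (N⁺? a q) q) (3 * k + 6) √-count-lower √-count-upper (≤-trans (proj₂ bounds) (m≤m+n (3 * k) 6)))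
    where
    difference : (+ S ((+ a) / q)) / 1 ℚ.- (+ S ((ℤ.- + q) / a)) / 1 ≡ (+ A ℤ.- + #T (N⁺? a q) q) / 1
    difference = nat-difference (S ((+ a) / q)) (S ((ℤ.- + q) / a)) A (#T (N⁺? a q) q)
      (subst₂ (λ s s′ → s + #T (N⁺? a q) q ≡ A + s′) (sym (S-reduced⁺ a q a⊥q)) (sym (S-reduced⁻ q a q⊥a)) plus-reciprocity)

  -- S(−a/q) − S(q/a) = N⁻ with 2 N⁻ ≤ 3 k + 1.
  E₋-estimate : ℚ.∣ (+ S ((ℤ.- + a) / q)) / 1 ℚ.- (+ S ((+ q) / a)) / 1 ∣ ℚ.≤ (+ (3 * k + 6)) / 2
  E₋-estimate = difference-estimate (S ((ℤ.- + a) / q)) (S ((+ q) / a)) (#T (N⁻? a q) q) (3 * k + 6)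
    (trans (S-reduced⁻ a q a⊥q) (trans minus-reciprocity (cong (_+ #T (N⁻? a q) q) (sym (S-reduced⁺ q a q⊥a)))))
    (≤-trans (proj₁ bounds) (+-monoʳ-≤ (3 * k) (s≤s z≤n)))

theorem1 : (a q : ℕ) → (1≤a : 1 ≤ a) → (a<q : a < q) → gcd a q ≡ 1 →
    let instance
          _ : ℕ.NonZero a
          _ = ℕ.>-nonZero 1≤a
          _ : ℕ.NonZero q
          _ = ℕ.>-nonZero (≤-trans 1≤a (<⇒≤ a<q))
        k = euclidSteps q a
        B = (+ (3 ℕ.* k ℕ.+ 6)) / 2
        Eplus+sqrt = (+ S ((+ a) / q)) / 1 ℚ.- (+ S ((ℤ.- (+ q)) / a)) / 1
        Eminus = (+ S ((ℤ.- (+ a)) / q)) / 1 ℚ.- (+ S ((+ q) / a)) / 1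
    in DistToSqrt≤ Eplus+sqrt ((+ q) / a) B × ℚ.∣ Eminus ∣ ℚ.≤ B
theorem1 a@(suc _) q 1≤a a<q a⊥q = E₊-estimate , E₋-estimate
  where
  instance
    _ : NonZero q
    _ = ℕ.>-nonZero (≤-trans 1≤a (<⇒≤ a<q))
  open ErrorTerms a q 1≤a a<q a⊥q
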